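{- Let $l$ be a prime, $g\ge1$, and let $\varphi:\mathrm{GSp}_{2g}(\mathbb{F}_l)\to\mathrm{GSp}_{2g}(\mathbb{F}_l)/\langle\pm1\rangle$ be the quotient map. If $G$ is a subgroup of $\mathrm{GSp}_{2g}(\mathbb{F}_l)$ such that $\varphi|_G$ is surjective, then $G=\mathrm{GSp}_{2g}(\mathbb{F}_l)$.
   Context: $\mathrm{GSp}_{2g}(\mathbb{F}_l)$ is the group of symplectic similitudes of the standard symplectic form on $\mathbb{F}_l^{2g}$. -}

module Defs where

open import Data.Nat as ℕ using (ℕ; zero; suc; NonZero; nonTrivial⇒nonZero)
open import Data.Nat.DivMod using (_mod_)
open import Data.Nat.Primality using (Prime)
import Data.Nat.Primality
open import Data.Fin as Fin using (Fin; toℕ; splitAt)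
open import Data.Fin.Properties using (_≟_)
open import Data.Vec using (Vec; lookup; tabulate; map)
open import Data.Sum using (_⊎_; inj₁; inj₂)
open import Data.Product using (Σ; _×_; ∃-syntax)
open import Relation.Binary.PropositionalEquality using (_≡_; _≢_)
open import Relation.Nullary using (does)
open import Data.Bool using (if_then_else_)

primeNonZero : ∀ {l} → Prime l → NonZero l
primeNonZero {l} (Data.Nat.Primality.prime _) = nonTrivial⇒nonZero l

module _ (l : ℕ) {{nz : NonZero l}} where

  F : Set
  F = Fin l

  0F 1F : F
  0F = 0 mod l
  1F = 1 mod l

  _+F_ _*F_ : F → F → F
  a +F b = (toℕ a ℕ.+ toℕ b) mod l
  a *F b = (toℕ a ℕ.* toℕ b) mod l

  -F_ : F → F
  -F a = (l ℕ.∸ toℕ a) mod l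

  sumF : ∀ n → (Fin n → F) → F
  sumF zero f = 0F
  sumF (suc n) f = f Fin.zero +F sumF n (λ i → f (Fin.suc i))

  Mat : ℕ → Set
  Mat n = Vec (Vec F n) n

  entry : ∀ {n} → Mat n → Fin n → Fin n → F
  entry A i j = lookup (lookup A i) j

  fromFun : ∀ {n} → (Fin n → Fin n → F) → Mat n
  fromFun f = tabulate λ i → tabulate λ j → f i j

  _*M_ : ∀ {n} → Mat n → Mat n → Mat n
  _*M_ {n} A B = fromFun λ i j → sumF n (λ k → entry A i k *F entry B k j)

  transpose : ∀ {n} → Mat n → Mat n
  transpose A = fromFun λ i j → entry A j i

  scal : ∀ {n} → F → Mat n → Mat n
  scal c A = map (map (c *F_)) A

  negM : ∀ {n} → Mat n → Mat n
  negM A = map (map -F_) A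

  idM : ∀ {n} → Mat n
  idM = fromFun λ i j → if does (i ≟ j) then 1F else 0F

  -- standard symplectic form J = [[0, I_g], [-I_g, 0]] on F_l^(g+g)
  Jstd : (g : ℕ) → Mat (g ℕ.+ g)
  Jstd g = fromFun λ i j → Jent (splitAt g i) (splitAt g j)
    where
    Jent : Fin g ⊎ Fin g → Fin g ⊎ Fin g → F
    Jent (inj₁ a) (inj₂ b) = if does (a ≟ b) then 1F else 0F
    Jent (inj₂ a) (inj₁ b) = if does (a ≟ b) then -F 1F else 0F
    Jent _ _ = 0F

  InGSp : (g : ℕ) → Mat (g ℕ.+ g) → Set
  InGSp g M = ∃[ c ] (c ≢ 0F × (transpose M *M (Jstd g *M M)) ≡ scal c (Jstd g))

  record IsSubgroupGSp (g : ℕ) (G : Mat (g ℕ.+ g) → Set) : Set where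
    field
      sub   : ∀ M → G M → InGSp g M
      one   : G idM
      mul   : ∀ M N → G M → G N → G (M *M N)
      inv   : ∀ M → G M → ∃[ N ] (G N × (M *M N) ≡ idM × (N *M M) ≡ idM)

  -- the quotient map φ : GSp → GSp/⟨±1⟩ restricted to G is surjective:
  -- every M ∈ GSp has a preimage N ∈ G with φ(N) = φ(M), i.e. N = ±M
  PhiSurjOn : (g : ℕ) (G : Mat (g ℕ.+ g) → Set) → Set
  PhiSurjOn g G = ∀ M → InGSp g M → ∃[ N ] (G N × (N ≡ M ⊎ N ≡ negM M))

module Submission where

-- The standard symplectic matrix J lies in GSp_{2g} (with multiplier 1) and
-- satisfies J² = (−J)² = −I. Surjectivity of φ|_G gives N ∈ G with N = ±J, hence
-- −I = N² ∈ G. For an arbitrary M ∈ GSp surjectivity gives N ∈ G with N = ±M; if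
-- N = −M then M = N·(−I) ∈ G.

open import Defs
open import Data.Nat using (ℕ; zero; suc; _+_; _*_; _∸_; _%_; _≤_; _<_; s≤s; NonZero; >-nonZero⁻¹; nonTrivial⇒n>1)
open import Data.Nat.Properties using (+-comm; +-assoc; +-identityʳ; *-comm; *-suc; *-zeroʳ; *-identityˡ; m∸n+n≡m; m∸n≤m; m∸[m∸n]≡n; <⇒≤; n<1+n)
open import Data.Nat.DivMod using (_mod_; n%1≡0; n%n≡0; m<n⇒m%n≡m; [m+kn]%n≡m%n; %-distribˡ-*)
open import Data.Nat.Primality using (Prime; prime⇒nonTrivial)
open import Data.Fin as Fin using (Fin; toℕ; splitAt; _↑ˡ_; _↑ʳ_; join)
open import Data.Fin.Properties using (_≟_; toℕ-injective; toℕ<n; toℕ-fromℕ<; splitAt-↑ˡ; splitAt-↑ʳ; join-splitAt; ↑ˡ-injective; ↑ʳ-injective)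
open import Data.Vec using (lookup; tabulate; map)
open import Data.Vec.Properties using (lookup∘tabulate; tabulate∘lookup; tabulate-cong; lookup-map)
open import Data.Sum using (_⊎_; inj₁; inj₂; [_,_]′)
open import Data.Product using (Σ; _,_; proj₁; proj₂)
open import Data.Bool using (true; false; if_then_else_)
open import Function.Bundles using (mk⇔)
open import Relation.Nullary using (does; yes; no)
open import Data.Empty using (⊥-elim)
open import Relation.Nullary.Decidable using (dec-false; does-⇔)
open import Relation.Binary.PropositionalEquality using (_≡_; _≢_; refl; sym; trans; cong; cong₂; subst; module ≡-Reasoning)

neg-one-*-% : ∀ l .{{_ : NonZero l}} a → a ≤ l → (((l ∸ 1 % l) % l) * a) % l ≡ (l ∸ a) % l
neg-one-*-% (suc zero) a _ = trans (n%1≡0 (1 % 1 % 1 * a)) (sym (n%1≡0 (1 ∸ a)))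
neg-one-*-% (suc (suc k)) a a≤l = begin
  ((suc k % L) * a) % L                 ≡⟨ cong (λ x → (x * a) % L) (m<n⇒m%n≡m (n<1+n (suc k))) ⟩
  (suc k * a) % L                       ≡⟨ sym ([m+kn]%n≡m%n (suc k * a) 1 L) ⟩
  (suc k * a + 1 * L) % L               ≡⟨ cong (_% L) shift ⟩
  (d + a * L) % L                       ≡⟨ [m+kn]%n≡m%n d a L ⟩
  d % L                                 ∎
  where
  open ≡-Reasoning
  L d : ℕ
  L = suc (suc k)
  d = L ∸ a
  -- (L − 1)·a + L = (L − a) + a·L, written without subtraction on the left
  shift : suc k * a + 1 * L ≡ d + a * L
  shift = begin
    suc k * a + 1 * L     ≡⟨ cong₂ _+_ (*-comm (suc k) a) (*-identityˡ L) ⟩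
    a * suc k + L         ≡⟨ +-comm (a * suc k) L ⟩
    L + a * suc k         ≡⟨ cong (_+ a * suc k) (sym (m∸n+n≡m a≤l)) ⟩
    (d + a) + a * suc k   ≡⟨ +-assoc d a (a * suc k) ⟩
    d + (a + a * suc k)   ≡⟨ cong (d +_) (sym (*-suc a (suc k))) ⟩
    d + a * L             ∎

neg-neg-% : ∀ l .{{_ : NonZero l}} x → x < l → (l ∸ (l ∸ x) % l) % l ≡ x
neg-neg-% l zero _ = trans (cong (λ y → (l ∸ y) % l) (n%n≡0 l)) (n%n≡0 l)
neg-neg-% (suc m) (suc y) y<l = begin
  (suc m ∸ (m ∸ y) % suc m) % suc m    ≡⟨ cong (λ z → (suc m ∸ z) % suc m) (m<n⇒m%n≡m (s≤s (m∸n≤m m y))) ⟩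
  (suc m ∸ (m ∸ y)) % suc m            ≡⟨ cong (_% suc m) (m∸[m∸n]≡n (<⇒≤ y<l)) ⟩
  suc y % suc m                        ≡⟨ m<n⇒m%n≡m y<l ⟩
  suc y                                ∎
  where open ≡-Reasoning

module ModularArithmetic (l : ℕ) {{nz : NonZero l}} where

  infixl 6 _⊕_
  infixl 7 _⊗_
  infix  8 ⊖_

  𝟘 𝟙 : F l
  𝟘 = 0F l
  𝟙 = 1F l

  _⊕_ _⊗_ : F l → F l → F l
  _⊕_ = _+F_ l
  _⊗_ = _*F_ l

  ⊖_ : F l → F l
  ⊖_ = -F_ l

  toℕ-mod : ∀ n → toℕ (n mod l) ≡ n % l
  toℕ-mod n = toℕ-fromℕ< _

  toℕ-%-id : (a : F l) → toℕ a % l ≡ toℕ a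
  toℕ-%-id a = m<n⇒m%n≡m (toℕ<n a)

  mod-toℕ : (a : F l) → toℕ a mod l ≡ a
  mod-toℕ a = toℕ-injective (trans (toℕ-mod (toℕ a)) (toℕ-%-id a))

  toℕ-𝟘 : toℕ 𝟘 ≡ 0
  toℕ-𝟘 = trans (toℕ-mod 0) (m<n⇒m%n≡m (>-nonZero⁻¹ l))

  ⊕-identityˡ : ∀ a → 𝟘 ⊕ a ≡ a
  ⊕-identityˡ a = trans (cong (λ x → (x + toℕ a) mod l) toℕ-𝟘) (mod-toℕ a)

  ⊕-identityʳ : ∀ a → a ⊕ 𝟘 ≡ a
  ⊕-identityʳ a =
    trans (cong (λ x → (toℕ a + x) mod l) toℕ-𝟘) (trans (cong (_mod l) (+-identityʳ (toℕ a))) (mod-toℕ a))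

  ⊗-zeroʳ : ∀ a → a ⊗ 𝟘 ≡ 𝟘
  ⊗-zeroʳ a = trans (cong (λ x → (toℕ a * x) mod l) toℕ-𝟘) (cong (_mod l) (*-zeroʳ (toℕ a)))

  ⊗-comm : ∀ a b → a ⊗ b ≡ b ⊗ a
  ⊗-comm a b = cong (_mod l) (*-comm (toℕ a) (toℕ b))

  ⊗-identityˡ : ∀ a → 𝟙 ⊗ a ≡ a
  ⊗-identityˡ a = toℕ-injective (begin
    toℕ (𝟙 ⊗ a)                  ≡⟨ toℕ-mod _ ⟩
    (toℕ 𝟙 * toℕ a) % l          ≡⟨ cong (λ x → (x * toℕ a) % l) (toℕ-mod 1) ⟩
    (1 % l * toℕ a) % l          ≡⟨ cong (λ x → (1 % l * x) % l) (sym (toℕ-%-id a)) ⟩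
    (1 % l * (toℕ a % l)) % l    ≡⟨ sym (%-distribˡ-* 1 (toℕ a) l) ⟩
    (1 * toℕ a) % l              ≡⟨ cong (_% l) (*-identityˡ (toℕ a)) ⟩
    toℕ a % l                    ≡⟨ toℕ-%-id a ⟩
    toℕ a                        ∎)
    where open ≡-Reasoning

  ⊗-identityʳ : ∀ a → a ⊗ 𝟙 ≡ a
  ⊗-identityʳ a = trans (⊗-comm a 𝟙) (⊗-identityˡ a)

  ⊖-zero : ⊖ 𝟘 ≡ 𝟘
  ⊖-zero = toℕ-injective (begin
    toℕ (⊖ 𝟘)          ≡⟨ toℕ-mod _ ⟩
    (l ∸ toℕ 𝟘) % l    ≡⟨ cong (λ x → (l ∸ x) % l) toℕ-𝟘 ⟩
    l % l              ≡⟨ n%n≡0 l ⟩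
    0                  ≡⟨ sym toℕ-𝟘 ⟩
    toℕ 𝟘              ∎)
    where open ≡-Reasoning

  ⊖-involutive : ∀ a → ⊖ ⊖ a ≡ a
  ⊖-involutive a = toℕ-injective (begin
    toℕ (⊖ ⊖ a)                       ≡⟨ toℕ-mod _ ⟩
    (l ∸ toℕ (⊖ a)) % l               ≡⟨ cong (λ x → (l ∸ x) % l) (toℕ-mod _) ⟩
    (l ∸ (l ∸ toℕ a) % l) % l         ≡⟨ neg-neg-% l (toℕ a) (toℕ<n a) ⟩
    toℕ a                             ∎)
    where open ≡-Reasoning

  ⊖𝟙-⊗ : ∀ a → ⊖ 𝟙 ⊗ a ≡ ⊖ a
  ⊖𝟙-⊗ a = toℕ-injective (begin
    toℕ (⊖ 𝟙 ⊗ a)                          ≡⟨ toℕ-mod _ ⟩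
    (toℕ (⊖ 𝟙) * toℕ a) % l                ≡⟨ cong (λ x → (x * toℕ a) % l) (toℕ-mod _) ⟩
    ((l ∸ toℕ 𝟙) % l * toℕ a) % l          ≡⟨ cong (λ x → ((l ∸ x) % l * toℕ a) % l) (toℕ-mod 1) ⟩
    ((l ∸ 1 % l) % l * toℕ a) % l          ≡⟨ neg-one-*-% l (toℕ a) (<⇒≤ (toℕ<n a)) ⟩
    (l ∸ toℕ a) % l                        ≡⟨ sym (toℕ-mod _) ⟩
    toℕ (⊖ a)                              ∎)
    where open ≡-Reasoning

  ⊗-⊖𝟙 : ∀ a → a ⊗ ⊖ 𝟙 ≡ ⊖ a
  ⊗-⊖𝟙 a = trans (⊗-comm a (⊖ 𝟙)) (⊖𝟙-⊗ a)

  𝟙≢𝟘 : 1 < l → 𝟙 ≢ 𝟘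
  𝟙≢𝟘 1<l 𝟙≡𝟘 with trans (sym (trans (toℕ-mod 1) (m<n⇒m%n≡m 1<l))) (trans (cong toℕ 𝟙≡𝟘) toℕ-𝟘)
  ... | ()

module Matrices (l : ℕ) {{nz : NonZero l}} where
  open ModularArithmetic l

  entry-fromFun : ∀ {n} (f : Fin n → Fin n → F l) i j → entry l (fromFun l f) i j ≡ f i j
  entry-fromFun f i j = trans (cong (λ row → lookup row j) (lookup∘tabulate (λ i → tabulate (f i)) i)) (lookup∘tabulate (f i) j)

  matrix-ext : ∀ {n} {A B : Mat l n} → (∀ i j → entry l A i j ≡ entry l B i j) → A ≡ B
  matrix-ext {A = A} {B} A≈B = begin
    A                                        ≡⟨ sym (tabulate∘lookup A) ⟩
    tabulate (λ i → lookup A i)              ≡⟨ tabulate-cong (λ i → row-ext i) ⟩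
    tabulate (λ i → lookup B i)              ≡⟨ tabulate∘lookup B ⟩
    B                                        ∎
    where
    open ≡-Reasoning
    row-ext : ∀ i → lookup A i ≡ lookup B i
    row-ext i = trans (sym (tabulate∘lookup (lookup A i)))
                  (trans (tabulate-cong (A≈B i)) (tabulate∘lookup (lookup B i)))

  entry-negM : ∀ {n} (A : Mat l n) i j → entry l (negM l A) i j ≡ ⊖ entry l A i j
  entry-negM A i j = trans (cong (λ row → lookup row j) (lookup-map i (map ⊖_) A)) (lookup-map j ⊖_ (lookup A i))

  entry-scal : ∀ {n} c (A : Mat l n) i j → entry l (scal l c A) i j ≡ c ⊗ entry l A i j
  entry-scal c A i j = trans (cong (λ row → lookup row j) (lookup-map i (map (c ⊗_)) A)) (lookup-map j (c ⊗_) (lookup A i))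

  if-⊗ : ∀ b x y → (if b then x else 𝟘) ⊗ y ≡ (if b then x ⊗ y else 𝟘)
  if-⊗ true  x y = refl
  if-⊗ false x y = trans (⊗-comm 𝟘 y) (⊗-zeroʳ y)

  ⊗-if : ∀ b x y → x ⊗ (if b then y else 𝟘) ≡ (if b then x ⊗ y else 𝟘)
  ⊗-if true  x y = refl
  ⊗-if false x y = ⊗-zeroʳ x

  ⊖-if : ∀ b x → ⊖ (if b then x else 𝟘) ≡ (if b then ⊖ x else 𝟘)
  ⊖-if true  x = refl
  ⊖-if false x = ⊖-zero

  sumF-cong : ∀ n {f h : Fin n → F l} → (∀ i → f i ≡ h i) → sumF l n f ≡ sumF l n h
  sumF-cong zero    f≈h = refl
  sumF-cong (suc n) f≈h = cong₂ _⊕_ (f≈h Fin.zero) (sumF-cong n (λ i → f≈h (Fin.suc i)))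

  sumF-zero : ∀ n → sumF l n (λ _ → 𝟘) ≡ 𝟘
  sumF-zero zero    = refl
  sumF-zero (suc n) = trans (cong (𝟘 ⊕_) (sumF-zero n)) (⊕-identityˡ 𝟘)

  sumF-delta : ∀ n (h : Fin n → F l) j → sumF l n (λ k → if does (k ≟ j) then h k else 𝟘) ≡ h j
  sumF-delta (suc n) h Fin.zero    = trans (cong (h Fin.zero ⊕_) (sumF-zero n)) (⊕-identityʳ (h Fin.zero))
  sumF-delta (suc n) h (Fin.suc j) = trans (⊕-identityˡ _) (sumF-delta n (λ k → h (Fin.suc k)) j)

  entry-negId : ∀ {n} (i j : Fin n) → entry l (negM l (idM l)) i j ≡ (if does (i ≟ j) then ⊖ 𝟙 else 𝟘)
  entry-negId i j = trans (entry-negM (idM l) i j) (trans (cong ⊖_ (entry-fromFun _ i j)) (⊖-if (does (i ≟ j)) 𝟙))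

  *-negId : ∀ {n} (A : Mat l n) → _*M_ l A (negM l (idM l)) ≡ negM l A
  *-negId {n} A = matrix-ext λ i j → begin
    entry l (_*M_ l A (negM l (idM l))) i j                              ≡⟨ entry-fromFun _ i j ⟩
    sumF l n (λ k → entry l A i k ⊗ entry l (negM l (idM l)) k j)        ≡⟨ sumF-cong n (λ k → trans (cong (entry l A i k ⊗_) (entry-negId k j)) (⊗-if (does (k ≟ j)) (entry l A i k) (⊖ 𝟙))) ⟩
    sumF l n (λ k → if does (k ≟ j) then entry l A i k ⊗ ⊖ 𝟙 else 𝟘)    ≡⟨ sumF-delta n _ j ⟩
    entry l A i j ⊗ ⊖ 𝟙                                                  ≡⟨ ⊗-⊖𝟙 (entry l A i j) ⟩
    ⊖ entry l A i j                                                      ≡⟨ sym (entry-negM A i j) ⟩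
    entry l (negM l A) i j                                               ∎
    where open ≡-Reasoning

  negM-involutive : ∀ {n} (A : Mat l n) → negM l (negM l A) ≡ A
  negM-involutive A = matrix-ext λ i j →
    trans (entry-negM (negM l A) i j) (trans (cong ⊖_ (entry-negM A i j)) (⊖-involutive _))

  scal-𝟙 : ∀ {n} (A : Mat l n) → scal l 𝟙 A ≡ A
  scal-𝟙 A = matrix-ext λ i j → trans (entry-scal 𝟙 A i j) (⊗-identityˡ _)

module Monomial (l : ℕ) {{nz : NonZero l}} {n : ℕ} (σ : Fin n → Fin n) (σ-involutive : ∀ i → σ (σ i) ≡ i) where
  open ModularArithmetic l
  open Matrices l

  mono : (Fin n → F l) → Mat l n
  mono e = fromFun l λ i k → if does (k ≟ σ i) then e i else 𝟘

  entry-mono : ∀ e i k → entry l (mono e) i k ≡ (if does (k ≟ σ i) then e i else 𝟘)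
  entry-mono e = entry-fromFun _

  mono-cong : ∀ {e e′} → (∀ i → e i ≡ e′ i) → mono e ≡ mono e′
  mono-cong {e} {e′} e≈e′ = matrix-ext λ i k → begin
    entry l (mono e) i k                     ≡⟨ entry-mono e i k ⟩
    (if does (k ≟ σ i) then e i else 𝟘)      ≡⟨ cong (λ x → if does (k ≟ σ i) then x else 𝟘) (e≈e′ i) ⟩
    (if does (k ≟ σ i) then e′ i else 𝟘)     ≡⟨ sym (entry-mono e′ i k) ⟩
    entry l (mono e′) i k                    ∎
    where open ≡-Reasoning

  entry-mono-* : ∀ e B i j → entry l (_*M_ l (mono e) B) i j ≡ e i ⊗ entry l B (σ i) j
  entry-mono-* e B i j = begin
    entry l (_*M_ l (mono e) B) i j                                     ≡⟨ entry-fromFun _ i j ⟩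
    sumF l n (λ k → entry l (mono e) i k ⊗ entry l B k j)               ≡⟨ sumF-cong n row-entry ⟩
    sumF l n (λ k → if does (k ≟ σ i) then e i ⊗ entry l B k j else 𝟘)  ≡⟨ sumF-delta n (λ k → e i ⊗ entry l B k j) (σ i) ⟩
    e i ⊗ entry l B (σ i) j                                             ∎
    where
    open ≡-Reasoning
    row-entry : ∀ k → entry l (mono e) i k ⊗ entry l B k j ≡ (if does (k ≟ σ i) then e i ⊗ entry l B k j else 𝟘)
    row-entry k = trans (cong (_⊗ entry l B k j) (entry-mono e i k)) (if-⊗ (does (k ≟ σ i)) (e i) (entry l B k j))

  mono-square : ∀ e → (∀ i → e i ⊗ e (σ i) ≡ ⊖ 𝟙) → _*M_ l (mono e) (mono e) ≡ negM l (idM l)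
  mono-square e e·eσ≡−1 = matrix-ext λ i j → begin
    entry l (_*M_ l (mono e) (mono e)) i j                   ≡⟨ entry-mono-* e (mono e) i j ⟩
    e i ⊗ entry l (mono e) (σ i) j                           ≡⟨ cong (e i ⊗_) (entry-mono e (σ i) j) ⟩
    e i ⊗ (if does (j ≟ σ (σ i)) then e (σ i) else 𝟘)        ≡⟨ ⊗-if (does (j ≟ σ (σ i))) (e i) (e (σ i)) ⟩
    (if does (j ≟ σ (σ i)) then e i ⊗ e (σ i) else 𝟘)        ≡⟨ cong₂ (λ b x → if b then x else 𝟘) (back-to-i i j) (e·eσ≡−1 i) ⟩
    (if does (i ≟ j) then ⊖ 𝟙 else 𝟘)                        ≡⟨ sym (entry-negId i j) ⟩
    entry l (negM l (idM l)) i j                             ∎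
    where
    open ≡-Reasoning
    back-to-i : ∀ i j → does (j ≟ σ (σ i)) ≡ does (i ≟ j)
    back-to-i i j = does-⇔ (mk⇔ (λ p → sym (trans p (σ-involutive i))) (λ p → trans (sym p) (sym (σ-involutive i))))
                      (j ≟ σ (σ i)) (i ≟ j)

  negM-mono : ∀ e → negM l (mono e) ≡ mono (λ i → ⊖ e i)
  negM-mono e = matrix-ext λ i k → begin
    entry l (negM l (mono e)) i k              ≡⟨ entry-negM (mono e) i k ⟩
    ⊖ entry l (mono e) i k                     ≡⟨ cong ⊖_ (entry-mono e i k) ⟩
    ⊖ (if does (k ≟ σ i) then e i else 𝟘)      ≡⟨ ⊖-if (does (k ≟ σ i)) (e i) ⟩
    (if does (k ≟ σ i) then ⊖ e i else 𝟘)      ≡⟨ sym (entry-mono (λ i → ⊖ e i) i k) ⟩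
    entry l (mono (λ i → ⊖ e i)) i k           ∎
    where open ≡-Reasoning

  transpose-mono : ∀ e → transpose l (mono e) ≡ mono (λ i → e (σ i))
  transpose-mono e = matrix-ext λ i j → begin
    entry l (transpose l (mono e)) i j           ≡⟨ entry-fromFun _ i j ⟩
    entry l (mono e) j i                         ≡⟨ entry-mono e j i ⟩
    (if does (i ≟ σ j) then e j else 𝟘)          ≡⟨ swap-roles i j ⟩
    (if does (j ≟ σ i) then e (σ i) else 𝟘)      ≡⟨ sym (entry-mono (λ i → e (σ i)) i j) ⟩
    entry l (mono (λ i → e (σ i))) i j           ∎
    where
    open ≡-Reasoning
    partner : ∀ {i j} → i ≡ σ j → j ≡ σ i
    partner {i} {j} i≡σj = trans (sym (σ-involutive j)) (cong σ (sym i≡σj))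
    swap-roles : ∀ i j → (if does (i ≟ σ j) then e j else 𝟘) ≡ (if does (j ≟ σ i) then e (σ i) else 𝟘)
    swap-roles i j with i ≟ σ j | j ≟ σ i
    ... | yes i≡σj | yes _    = cong e (partner i≡σj)
    ... | yes i≡σj | no  j≢σi = ⊥-elim (j≢σi (partner i≡σj))
    ... | no  i≢σj | yes j≡σi = ⊥-elim (i≢σj (partner j≡σi))
    ... | no  _    | no  _    = refl

-- The standard symplectic matrix J = [[0, I], [−I, 0]] as a monomial matrix.
module StandardForm (l : ℕ) {{nz : NonZero l}} (g : ℕ) where
  open ModularArithmetic l
  open Matrices l

  data Half : Fin (g + g) → Set where
    left  : (a : Fin g) → Half (a ↑ˡ g)
    right : (a : Fin g) → Half (g ↑ʳ a)

  half : ∀ i → Half i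
  half i = subst Half (join-splitAt g g i) (by-split (splitAt g i))
    where
    by-split : (s : Fin g ⊎ Fin g) → Half (join g g s)
    by-split (inj₁ a) = left a
    by-split (inj₂ a) = right a

  swap : Fin (g + g) → Fin (g + g)
  swap i = [ g ↑ʳ_ , _↑ˡ g ]′ (splitAt g i)

  sign : Fin (g + g) → F l
  sign i = [ (λ _ → 𝟙) , (λ _ → ⊖ 𝟙) ]′ (splitAt g i)

  swap-left : ∀ a → swap (a ↑ˡ g) ≡ g ↑ʳ a
  swap-left a = cong [ g ↑ʳ_ , _↑ˡ g ]′ (splitAt-↑ˡ g a g)

  swap-right : ∀ a → swap (g ↑ʳ a) ≡ a ↑ˡ g
  swap-right a = cong [ g ↑ʳ_ , _↑ˡ g ]′ (splitAt-↑ʳ g g a)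

  sign-left : ∀ a → sign (a ↑ˡ g) ≡ 𝟙
  sign-left a = cong [ (λ _ → 𝟙) , (λ _ → ⊖ 𝟙) ]′ (splitAt-↑ˡ g a g)

  sign-right : ∀ a → sign (g ↑ʳ a) ≡ ⊖ 𝟙
  sign-right a = cong [ (λ _ → 𝟙) , (λ _ → ⊖ 𝟙) ]′ (splitAt-↑ʳ g g a)

  swap-involutive : ∀ i → swap (swap i) ≡ i
  swap-involutive i with half i
  ... | left a  = trans (cong swap (swap-left a)) (swap-right a)
  ... | right a = trans (cong swap (swap-right a)) (swap-left a)

  open Monomial l swap swap-involutive

  -- Jstd is `fromFun` of a function local to its definition; unification names it
  Jstd-as-fromFun : Σ (Fin (g + g) → Fin (g + g) → F l) λ f → Jstd l g ≡ fromFun l f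
  Jstd-as-fromFun = _ , refl

  halves-disjoint : ∀ a b → a ↑ˡ g ≢ g ↑ʳ b
  halves-disjoint a b p with trans (sym (splitAt-↑ˡ g a g)) (trans (cong (splitAt g) p) (splitAt-↑ʳ g g b))
  ... | ()

  Jstd-entry : ∀ i j → proj₁ Jstd-as-fromFun i j ≡ (if does (j ≟ swap i) then sign i else 𝟘)
  Jstd-entry i j with half i | half j
  ... | left a  | left b  rewrite splitAt-↑ˡ g a g | splitAt-↑ˡ g b g =
    cong (λ c → if c then 𝟙 else 𝟘) (sym (dec-false (b ↑ˡ g ≟ g ↑ʳ a) (halves-disjoint b a)))
  ... | left a  | right b rewrite splitAt-↑ˡ g a g | splitAt-↑ʳ g g b =
    cong (λ c → if c then 𝟙 else 𝟘)
      (does-⇔ (mk⇔ (λ a≡b → cong (g ↑ʳ_) (sym a≡b)) (λ p → sym (↑ʳ-injective g b a p))) (a ≟ b) (g ↑ʳ b ≟ g ↑ʳ a))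
  ... | right a | left b  rewrite splitAt-↑ʳ g g a | splitAt-↑ˡ g b g =
    cong (λ c → if c then ⊖ 𝟙 else 𝟘)
      (does-⇔ (mk⇔ (λ a≡b → cong (_↑ˡ g) (sym a≡b)) (λ p → sym (↑ˡ-injective g b a p))) (a ≟ b) (b ↑ˡ g ≟ a ↑ˡ g))
  ... | right a | right b rewrite splitAt-↑ʳ g g a | splitAt-↑ʳ g g b =
    cong (λ c → if c then ⊖ 𝟙 else 𝟘) (sym (dec-false (g ↑ʳ b ≟ a ↑ˡ g) (λ p → halves-disjoint a b (sym p))))

  J : Mat l (g + g)
  J = Jstd l g

  J-mono : J ≡ mono sign
  J-mono = trans (proj₂ Jstd-as-fromFun) (matrix-ext λ i j →
    trans (entry-fromFun _ i j) (trans (Jstd-entry i j) (sym (entry-mono sign i j))))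

  neg-sign : ∀ i → ⊖ sign i ≡ sign (swap i)
  neg-sign i with half i
  ... | left a  = trans (cong ⊖_ (sign-left a)) (sym (trans (cong sign (swap-left a)) (sign-right a)))
  ... | right a = begin
    ⊖ sign (g ↑ʳ a)      ≡⟨ cong ⊖_ (sign-right a) ⟩
    ⊖ ⊖ 𝟙                ≡⟨ ⊖-involutive 𝟙 ⟩
    𝟙                    ≡⟨ sym (sign-left a) ⟩
    sign (a ↑ˡ g)        ≡⟨ cong sign (sym (swap-right a)) ⟩
    sign (swap (g ↑ʳ a)) ∎
    where open ≡-Reasoning

  sign-square : ∀ i → sign i ⊗ sign (swap i) ≡ ⊖ 𝟙
  sign-square i with half i
  ... | left a  = trans (cong₂ _⊗_ (sign-left a) (trans (cong sign (swap-left a)) (sign-right a))) (⊗-identityˡ (⊖ 𝟙))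
  ... | right a = trans (cong₂ _⊗_ (sign-right a) (trans (cong sign (swap-right a)) (sign-left a))) (⊗-identityʳ (⊖ 𝟙))

  J-square : _*M_ l J J ≡ negM l (idM l)
  J-square = trans (cong₂ (_*M_ l) J-mono J-mono) (mono-square sign sign-square)

  negJ-mono : negM l J ≡ mono (λ i → sign (swap i))
  negJ-mono = trans (cong (negM l) J-mono) (trans (negM-mono sign) (mono-cong neg-sign))

  negJ-square : _*M_ l (negM l J) (negM l J) ≡ negM l (idM l)
  negJ-square = trans (cong₂ (_*M_ l) negJ-mono negJ-mono) (mono-square (λ i → sign (swap i)) (λ i → sign-square (swap i)))

  J-antisymmetric : negM l (transpose l J) ≡ J
  J-antisymmetric = begin
    negM l (transpose l J)                   ≡⟨ cong (λ A → negM l (transpose l A)) J-mono ⟩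
    negM l (transpose l (mono sign))         ≡⟨ cong (negM l) (transpose-mono sign) ⟩
    negM l (mono (λ i → sign (swap i)))      ≡⟨ negM-mono (λ i → sign (swap i)) ⟩
    mono (λ i → ⊖ sign (swap i))             ≡⟨ mono-cong (λ i → trans (neg-sign (swap i)) (cong sign (swap-involutive i))) ⟩
    mono sign                                ≡⟨ sym J-mono ⟩
    J                                        ∎
    where open ≡-Reasoning

  J-in-GSp : 1 < l → InGSp l g J
  J-in-GSp 1<l = 𝟙 , 𝟙≢𝟘 1<l , (begin
    _*M_ l (transpose l J) (_*M_ l J J)                ≡⟨ cong (_*M_ l (transpose l J)) J-square ⟩
    _*M_ l (transpose l J) (negM l (idM l))            ≡⟨ *-negId (transpose l J) ⟩
    negM l (transpose l J)                             ≡⟨ J-antisymmetric ⟩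
    J                                                  ≡⟨ sym (scal-𝟙 J) ⟩
    scal l 𝟙 J                                         ∎)
    where open ≡-Reasoning

module SubgroupLifts (l : ℕ) {{nz : NonZero l}} (g : ℕ) {G : Mat l (g + g) → Set} (G-sub : IsSubgroupGSp l g G) where
  open Matrices l
  open IsSubgroupGSp G-sub using (mul)

  negId-from-lift : ∀ X N → _*M_ l X X ≡ negM l (idM l) → _*M_ l (negM l X) (negM l X) ≡ negM l (idM l) →
                    G N → N ≡ X ⊎ N ≡ negM l X → G (negM l (idM l))
  negId-from-lift X N X² -X² N∈G (inj₁ N≡X)  = subst G (trans (cong₂ (_*M_ l) N≡X N≡X) X²) (mul N N N∈G N∈G)
  negId-from-lift X N X² -X² N∈G (inj₂ N≡-X) = subst G (trans (cong₂ (_*M_ l) N≡-X N≡-X) -X²) (mul N N N∈G N∈G)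

  mem-from-lift : G (negM l (idM l)) → ∀ M N → G N → N ≡ M ⊎ N ≡ negM l M → G M
  mem-from-lift _     M N N∈G (inj₁ N≡M)  = subst G N≡M N∈G
  mem-from-lift -I∈G M N N∈G (inj₂ N≡-M) =
    subst G (trans (cong (λ A → _*M_ l A (negM l (idM l))) N≡-M) (trans (*-negId (negM l M)) (negM-involutive M)))
      (mul N (negM l (idM l)) N∈G -I∈G)

mainTheorem7 : (l : ℕ) (pl : Prime l) (g : ℕ) → 1 ≤ g →
    (G : Mat l {{primeNonZero pl}} (g Data.Nat.+ g) → Set) →
    IsSubgroupGSp l {{primeNonZero pl}} g G →
    PhiSurjOn l {{primeNonZero pl}} g G →
    ∀ M → InGSp l {{primeNonZero pl}} g M → G M
mainTheorem7 l pl g _ G G-sub φ-onto M M∈GSp with φ-onto M M∈GSp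
... | N , N∈G , N≡±M = mem-from-lift -I∈G M N N∈G N≡±M
  where
  open StandardForm l {{primeNonZero pl}} g
  open SubgroupLifts l {{primeNonZero pl}} g G-sub
  -- a prime is > 1, so F_l is a nonzero ring and J has a legitimate multiplier
  J∈GSp : InGSp l {{primeNonZero pl}} g J
  J∈GSp = J-in-GSp (nonTrivial⇒n>1 l {{prime⇒nonTrivial pl}})
  -I∈G : G (negM l {{primeNonZero pl}} (idM l {{primeNonZero pl}}))
  -I∈G with φ-onto J J∈GSp
  ... | N′ , N′∈G , N′≡±J = negId-from-lift J N′ J-square negJ-square N′∈G N′≡±J
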